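{- Let $\langle A,B,C\rangle\in\mathcal{S}\setminus\mathcal{B}$ and let $\langle A',B',C'\rangle$ be a complement of $\langle A,B,C\rangle$ in $\mathcal{S}$. If $B\subseteq A$, then $B'\not\subseteq A'$.
   Context: Let $\kappa$ be an infinite cardinal, identified with the set of ordinals less than $\kappa$. Let $\mathcal{F}(\kappa)=\{X\subseteq\kappa : X \text{ is finite or } \kappa\setminus X \text{ is finite}\}$. For $A,C\in\mathcal{F}(\kappa)$, write $A\sim C$ if either both $A$ and $C$ are finite, or both $\kappa\setminus A$ and $\kappa\setminus C$ are finite. For subsets $A,B,C\subseteq\kappa$ put $\mu\langle A,B,C\rangle=(A\cap B)\cup(A\cap C)\cup(B\cap C)$ and $\overline{\langle A,B,C\rangle}=\langle A\cup\mu,\ B\cup\mu,\ C\cup\mu\rangle$ with $\mu=\mu\langle A,B,C\rangle$. A triple is balanced if $A\cap B=A\cap C=B\cap C$. $M_3[\mathcal{F}(\kappa)]$ is the lattice of balanced triples in $\mathcal{F}(\kappa)^3$, ordered componentwise, with meet the componentwise intersection and join $\langle A,B,C\rangle\vee\langle A',B',C'\rangle=\overline{\langle A\cup A',B\cup B',C\cup C'\rangle}$. Let $\mathcal{S}=\{\langle A,B,C\rangle\in M_3[\mathcal{F}(\kappa)] : C\setminus\mu\langle A,B,C\rangle\text{ is finite}\}$, a bounded sublattice of $M_3[\mathcal{F}(\kappa)]$ with bounds $0_{\mathcal S}=\langle\emptyset,\emptyset,\emptyset\rangle$ and $1_{\mathcal S}=\langle\kappa,\kappa,\kappa\rangle$;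 a complement of $x$ in $\mathcal{S}$ is $y\in\mathcal{S}$ with $x\wedge y=0_{\mathcal S}$ and $x\vee y=1_{\mathcal S}$. Let $\mathcal{B}=\{\langle A,A\cap C,C\rangle : A,C\in\mathcal{F}(\kappa),\ A\sim C\}\subseteq\mathcal{S}$. -}

module Defs where

open import Level using (0ℓ)
open import Data.Product using (Σ; _×_; _,_; ∃)
open import Data.Sum using (_⊎_)
open import Data.List using (List)
open import Data.List.Membership.Propositional using (_∈_)
open import Relation.Nullary using (¬_)
open import Relation.Unary using (Pred; _⊆_; _≐_; _∩_; _∪_; ∁; ∅; U; _∖_)

-- Subsets of the underlying set K (playing the role of κ).
Sub : Set → Set₁
Sub K = Pred K 0ℓ

-- K is infinite: no finite list exhausts it (constructive form: every list misses a point).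
Infinite : Set → Set
Infinite K = (xs : List K) → ∃ λ x → ¬ (x ∈ xs)

Finite : {K : Set} → Sub K → Set
Finite {K} X = Σ (List K) λ xs → ∀ x → X x → x ∈ xs

Cofinite : {K : Set} → Sub K → Set
Cofinite X = Finite (∁ X)

InF : {K : Set} → Sub K → Set
InF X = Finite X ⊎ Cofinite X

_∼_ : {K : Set} → Sub K → Sub K → Set
A ∼ C = (Finite A × Finite C) ⊎ (Cofinite A × Cofinite C)

record Triple (K : Set) : Set₁ where
  constructor ⟨_,_,_⟩
  field
    fst snd thd : Sub K
open Triple public

_≈T_ : {K : Set} → Triple K → Triple K → Set
x ≈T y = (fst x ≐ fst y) × (snd x ≐ snd y) × (thd x ≐ thd y)

μ : {K : Set} → Triple K → Sub K
μ ⟨ A , B , C ⟩ = (A ∩ B) ∪ (A ∩ C) ∪ (B ∩ C)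

closure : {K : Set} → Triple K → Triple K
closure t = ⟨ fst t ∪ μ t , snd t ∪ μ t , thd t ∪ μ t ⟩

Balanced : {K : Set} → Triple K → Set
Balanced ⟨ A , B , C ⟩ = ((A ∩ B) ≐ (A ∩ C)) × ((A ∩ C) ≐ (B ∩ C))

InM3 : {K : Set} → Triple K → Set
InM3 t = InF (fst t) × InF (snd t) × InF (thd t) × Balanced t

InS : {K : Set} → Triple K → Set
InS t = InM3 t × Finite (thd t ∖ μ t)

InB : {K : Set} → Triple K → Set₁
InB {K} t = Σ (Sub K) λ A → Σ (Sub K) λ C →
  InF A × InF C × (A ∼ C) × (t ≈T ⟨ A , A ∩ C , C ⟩)

_∧T_ : {K : Set} → Triple K → Triple K → Triple K
x ∧T y = ⟨ fst x ∩ fst y , snd x ∩ snd y , thd x ∩ thd y ⟩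

_∨T_ : {K : Set} → Triple K → Triple K → Triple K
x ∨T y = closure ⟨ fst x ∪ fst y , snd x ∪ snd y , thd x ∪ thd y ⟩

0T : {K : Set} → Triple K
0T = ⟨ ∅ , ∅ , ∅ ⟩

1T : {K : Set} → Triple K
1T = ⟨ U , U , U ⟩

IsComplement : {K : Set} → Triple K → Triple K → Set
IsComplement x y = InS y × ((x ∧T y) ≈T 0T) × ((x ∨T y) ≈T 1T)

-- Since B ⊆ A, balancedness forces B = A ∩ C, so the triple lies outside 𝓑 exactly
-- when one of A, C is finite and the other cofinite. In 𝓢 the third component differs
-- from μ by a finite set, so it cannot be cofinite while μ is finite. If A is finite,
-- μ ⊆ A is finite, so C is not cofinite. If C is finite and A cofinite, a complement
-- with B' ⊆ A' has A' ⊆ κ ∖ A finite, hence finite μ', while the join being 1 makes C'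
-- cofinite, since its third component is covered by C ∪ A' ∪ C'.
module Submission where

open import Defs
open import Relation.Nullary using (¬_)
open import Relation.Unary using (_⊆_; _∪_; _∩_; ∁; _∖_)
open import Data.Product using (_×_; _,_; proj₁; proj₂; ∃)
open import Data.Sum using (_⊎_; inj₁; inj₂)
open import Data.Empty using (⊥-elim)
open import Data.Unit using (tt)
open import Data.List using (_++_)
open import Data.List.Membership.Propositional.Properties using (∈-++⁺ˡ; ∈-++⁺ʳ)

module _ {K : Set} where

  finite-⊆ : {X Y : Sub K} → X ⊆ Y → Finite Y → Finite X
  finite-⊆ X⊆Y (ys , Y⊆ys) = ys , λ x Xx → Y⊆ys x (X⊆Y Xx)

  finite-∪ : {X Y : Sub K} → Finite X → Finite Y → Finite (X ∪ Y)
  finite-∪ (xs , X⊆xs) (ys , Y⊆ys) = xs ++ ys , λ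
    { x (inj₁ Xx) → ∈-++⁺ˡ (X⊆xs x Xx)
    ; x (inj₂ Yx) → ∈-++⁺ʳ xs (Y⊆ys x Yx) }

  ∃-∉-finite : Infinite K → {X : Sub K} → Finite X → ∃ λ x → ¬ X x
  ∃-∉-finite inf (xs , X⊆xs) with inf xs
  ... | x , x∉xs = x , λ Xx → x∉xs (X⊆xs x Xx)

  finite-∖-finite⇒¬cofinite : Infinite K → {Y Z : Sub K} →
    Finite Y → Finite (Z ∖ Y) → ¬ Cofinite Z
  finite-∖-finite⇒¬cofinite inf {Y} {Z} finY finZ∖Y cofZ
    with ∃-∉-finite inf (finite-∪ finY (finite-∪ finZ∖Y cofZ))
  ... | x , x∉ = x∉ (inj₂ (inj₂ ¬Zx))
    where
    ¬Zx : ¬ Z x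
    ¬Zx Zx = x∉ (inj₂ (inj₁ (Zx , λ Yx → x∉ (inj₁ Yx))))

  μ⊆fst : (t : Triple K) → snd t ⊆ fst t → μ t ⊆ fst t
  μ⊆fst t B⊆A (inj₁ (a , _))        = a
  μ⊆fst t B⊆A (inj₂ (inj₁ (a , _))) = a
  μ⊆fst t B⊆A (inj₂ (inj₂ (b , _))) = B⊆A b

  μ⊆snd∪thd : (t : Triple K) → μ t ⊆ snd t ∪ thd t
  μ⊆snd∪thd t (inj₁ (_ , b))        = inj₁ b
  μ⊆snd∪thd t (inj₂ (inj₁ (_ , c))) = inj₂ c
  μ⊆snd∪thd t (inj₂ (inj₂ (b , _))) = inj₁ b

  thd-closure⊆snd∪thd : (t : Triple K) → thd (closure t) ⊆ snd t ∪ thd t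
  thd-closure⊆snd∪thd t (inj₁ c)  = inj₂ c
  thd-closure⊆snd∪thd t (inj₂ m)  = μ⊆snd∪thd t m

  InS-finite-μ⇒¬cofinite-thd : Infinite K → (t : Triple K) →
    InS t → Finite (μ t) → ¬ Cofinite (thd t)
  InS-finite-μ⇒¬cofinite-thd inf t (_ , finC∖μ) finμ =
    finite-∖-finite⇒¬cofinite inf finμ finC∖μ

  ∧T≈0T⇒fst-disjoint : (x y : Triple K) → (x ∧T y) ≈T 0T → fst y ⊆ ∁ (fst x)
  ∧T≈0T⇒fst-disjoint x y (meet₁ , _) a' a = proj₁ meet₁ (a , a')

  balanced-snd⊆fst⇒snd≐fst∩thd : {A B C : Sub K} → Balanced ⟨ A , B , C ⟩ → B ⊆ A →
    (B ⊆ A ∩ C) × (A ∩ C ⊆ B)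
  balanced-snd⊆fst⇒snd≐fst∩thd (A∩B≐A∩C , _) B⊆A =
    (λ b → proj₁ A∩B≐A∩C (B⊆A b , b)) , (λ a∩c → proj₂ (proj₂ A∩B≐A∩C a∩c))

  ¬InB⇒finite-cofinite : {A B C : Sub K} → InS ⟨ A , B , C ⟩ → ¬ InB ⟨ A , B , C ⟩ →
    B ⊆ A → (Finite A × Cofinite C) ⊎ (Cofinite A × Finite C)
  ¬InB⇒finite-cofinite {A} {B} {C} ((finA , _ , finC , bal) , _) ¬InB B⊆A =
    split finA finC
    where
    B≐A∩C : (B ⊆ A ∩ C) × (A ∩ C ⊆ B)
    B≐A∩C = balanced-snd⊆fst⇒snd≐fst∩thd bal B⊆A

    ¬A∼C : ¬ (A ∼ C)
    ¬A∼C A∼C = ¬InB (A , C , finA , finC , A∼C ,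
      ((λ a → a) , (λ a → a)) , B≐A∩C , ((λ c → c) , (λ c → c)))

    split : InF A → InF C → (Finite A × Cofinite C) ⊎ (Cofinite A × Finite C)
    split (inj₁ finA) (inj₁ finC) = ⊥-elim (¬A∼C (inj₁ (finA , finC)))
    split (inj₁ finA) (inj₂ cofC) = inj₁ (finA , cofC)
    split (inj₂ cofA) (inj₁ finC) = inj₂ (cofA , finC)
    split (inj₂ cofA) (inj₂ cofC) = ⊥-elim (¬A∼C (inj₂ (cofA , cofC)))

lemma5p4 : (K : Set) → Infinite K → (A B C A' B' C' : Sub K) →
    InS ⟨ A , B , C ⟩ → ¬ InB ⟨ A , B , C ⟩ →
    IsComplement ⟨ A , B , C ⟩ ⟨ A' , B' , C' ⟩ →
    B ⊆ A → ¬ (B' ⊆ A')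
lemma5p4 K inf A B C A' B' C' S@((_ , _ , _ , bal) , _) ¬InB
         (S' , meet , (_ , _ , join₃)) B⊆A B'⊆A'
  with ¬InB⇒finite-cofinite S ¬InB B⊆A
... | inj₁ (finA , cofC) =
  InS-finite-μ⇒¬cofinite-thd inf t S (finite-⊆ (μ⊆fst t B⊆A) finA) cofC
  where t = ⟨ A , B , C ⟩
... | inj₂ (cofA , finC) =
  InS-finite-μ⇒¬cofinite-thd inf t' S' (finite-⊆ (μ⊆fst t' B'⊆A') finA') cofC'
  where
  t  = ⟨ A , B , C ⟩
  t' = ⟨ A' , B' , C' ⟩
  B⊆C : B ⊆ C
  B⊆C b = proj₂ (proj₁ (balanced-snd⊆fst⇒snd≐fst∩thd bal B⊆A) b)
  finA' : Finite A'
  finA' = finite-⊆ (∧T≈0T⇒fst-disjoint t t' meet) cofA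
  ∁C'⊆C∪A' : ∁ C' ⊆ C ∪ A'
  ∁C'⊆C∪A' {x} ¬C'x
    with thd-closure⊆snd∪thd ⟨ A ∪ A' , B ∪ B' , C ∪ C' ⟩ (proj₂ join₃ {x} tt)
  ... | inj₁ (inj₁ b)  = inj₁ (B⊆C b)
  ... | inj₁ (inj₂ b') = inj₂ (B'⊆A' b')
  ... | inj₂ (inj₁ c)  = inj₁ c
  ... | inj₂ (inj₂ c') = ⊥-elim (¬C'x c')
  cofC' : Cofinite C'
  cofC' = finite-⊆ ∁C'⊆C∪A' (finite-∪ finC finA')
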